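{- Let $(C,\le)$ and $(A,\le_A)$ be complete lattices and let $\alpha:C\to A$, $\gamma:A\to C$ form a Galois insertion. Let $\alpha_p:\mathcal P(C)\to\mathcal P(A)$ be the pointwise abstraction $\alpha_p(X)=\{\alpha(c)\mid c\in X\}$. Then for every indexed family $(X_i)_{i\in I}$ of subsets of $C$, $\alpha_p\big(\bigoplus_{i\in I}X_i\big)=\bigoplus_{i\in I}\alpha_p(X_i)$, where on both sides $\oplus$ is the hyper sum described in the context.
   Context: A Galois insertion between complete lattices consists of monotone maps $\alpha:C\to A$, $\gamma:A\to C$ with $\alpha(c)\le_A a\iff c\le\gamma(a)$ and $\alpha$ surjective. The pointwise abstraction also has concretization $\gamma_p(Y)=\{X\in\mathcal P(C)\mid\alpha_p(X)\in Y\}$. Hyper sum on $\mathcal P(C)$: for a family $(X_i)_{i\in I}$ of subsets of $C$, $\bigoplus_{i\in I}X_i=\{\bigvee_{i\in I}x_i\mid x_i\in X_i\text{ for all }i\in I\}$, where $\bigvee$ is the join of $C$; the hyper sum on $\mathcal P(A)$ is defined in the same way using the join of $A$. -}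

module Defs where

open import Level using (Level; _⊔_; suc)
open import Data.Product using (Σ; _×_; _,_)
open import Relation.Binary.Bundles using (Poset)
open import Relation.Binary.Definitions using (Monotonic₁)

record CompleteLattice (c ℓ₁ ℓ₂ ι : Level) : Set (suc (c ⊔ ℓ₁ ⊔ ℓ₂ ⊔ ι)) where
  field
    poset : Poset c ℓ₁ ℓ₂
  open Poset poset public
  field
    ⋁        : {I : Set ι} → (I → Carrier) → Carrier
    ⋁-upper  : {I : Set ι} (f : I → Carrier) (i : I) → f i ≤ ⋁ f
    ⋁-least  : {I : Set ι} (f : I → Carrier) (z : Carrier) →
               (∀ i → f i ≤ z) → ⋁ f ≤ z

𝒫 : {c : Level} (s : Level) → Set c → Set (c ⊔ suc s)
𝒫 s X = X → Set s

module _ {c ℓ₁ ℓ₂ ι : Level} (L : CompleteLattice c ℓ₁ ℓ₂ ι) where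
  open CompleteLattice L

  _≐_ : {s t : Level} → 𝒫 s Carrier → 𝒫 t Carrier → Set (c ⊔ s ⊔ t)
  X ≐ Y = (∀ z → X z → Y z) × (∀ z → Y z → X z)

  ⨁ : {s : Level} {I : Set ι} → (I → 𝒫 s Carrier) → 𝒫 (c ⊔ ℓ₁ ⊔ ι ⊔ s) Carrier
  ⨁ {I = I} X z = Σ (I → Carrier) λ x → (∀ i → X i (x i)) × (⋁ x ≈ z)

record IsGaloisInsertion {c ℓ₁ ℓ₂ a m₁ m₂ ι : Level}
    (C : CompleteLattice c ℓ₁ ℓ₂ ι) (A : CompleteLattice a m₁ m₂ ι)
    (α : CompleteLattice.Carrier C → CompleteLattice.Carrier A)
    (γ : CompleteLattice.Carrier A → CompleteLattice.Carrier C)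
    : Set (c ⊔ ℓ₁ ⊔ ℓ₂ ⊔ a ⊔ m₁ ⊔ m₂) where
  private
    module C = CompleteLattice C
    module A = CompleteLattice A
  field
    α-mono     : Monotonic₁ C._≤_ A._≤_ α
    γ-mono     : Monotonic₁ A._≤_ C._≤_ γ
    adjoint→   : ∀ x y → α x A.≤ y → x C.≤ γ y
    adjoint←   : ∀ x y → x C.≤ γ y → α x A.≤ y
    α-surj     : ∀ y → Σ C.Carrier λ x → α x A.≈ y

αₚ : {c a ℓ s : Level} {Cr : Set c} {Ar : Set a} (_≈_ : Ar → Ar → Set ℓ) →
     (Cr → Ar) → 𝒫 s Cr → 𝒫 (c ⊔ ℓ ⊔ s) Ar
αₚ _≈_ α X y = Σ _ λ x → X x × (α x ≈ y)

{-# OPTIONS --safe #-}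
-- As a lower adjoint, α preserves all joins. So α(⋁ xᵢ) = ⋁ α(xᵢ): the image of a
-- concrete sum is the abstract sum of the images, and every family of images α(xᵢ)
-- summed in A comes from the concrete sum of the xᵢ.
module Submission where

open import Defs
open import Level using (Level; _⊔_; suc)
open import Data.Product using (_,_; proj₁; proj₂)
open import Function using (_∘_)
open import Relation.Binary.Definitions using (Monotonic₁)
open import Relation.Binary.Core using (_Preserves_⟶_)

module _ {c ℓ₁ ℓ₂ ι : Level} (L : CompleteLattice c ℓ₁ ℓ₂ ι) where
  open CompleteLattice L

  ⋁-cong : {I : Set ι} {f g : I → Carrier} → (∀ i → f i ≈ g i) → ⋁ f ≈ ⋁ g
  ⋁-cong {f = f} {g} f≈g = antisym
    (⋁-least f _ λ i → trans (reflexive (f≈g i)) (⋁-upper g i))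
    (⋁-least g _ λ i → trans (reflexive (Eq.sym (f≈g i))) (⋁-upper f i))

module _ {c ℓ₁ ℓ₂ a m₁ m₂ ι : Level}
         (C : CompleteLattice c ℓ₁ ℓ₂ ι) (A : CompleteLattice a m₁ m₂ ι) where
  private
    module C = CompleteLattice C
    module A = CompleteLattice A

  PreservesJoins : (C.Carrier → A.Carrier) → Set (c ⊔ m₁ ⊔ suc ι)
  PreservesJoins f = {I : Set ι} (xs : I → C.Carrier) → f (C.⋁ xs) A.≈ A.⋁ (f ∘ xs)

  monotone⇒cong : {f : C.Carrier → A.Carrier} →
                  Monotonic₁ C._≤_ A._≤_ f → f Preserves C._≈_ ⟶ A._≈_
  monotone⇒cong f-mono x≈y =
    A.antisym (f-mono (C.reflexive x≈y)) (f-mono (C.reflexive (C.Eq.sym x≈y)))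

  galoisInsertion⇒preservesJoins : {α : C.Carrier → A.Carrier} {γ : A.Carrier → C.Carrier} →
                                   IsGaloisInsertion C A α γ → PreservesJoins α
  galoisInsertion⇒preservesJoins {α} G xs = A.antisym
    (adjoint← _ _ (C.⋁-least xs _ λ i → adjoint→ _ _ (A.⋁-upper (α ∘ xs) i)))
    (A.⋁-least (α ∘ xs) _ λ i → α-mono (C.⋁-upper xs i))
    where open IsGaloisInsertion G

  αₚ-⨁ : {s : Level} {f : C.Carrier → A.Carrier} →
         Monotonic₁ C._≤_ A._≤_ f → PreservesJoins f →
         {I : Set ι} (X : I → 𝒫 s C.Carrier) →
         _≐_ A (αₚ A._≈_ f (⨁ C X)) (⨁ A (αₚ A._≈_ f ∘ X))
  αₚ-⨁ {f = f} f-mono f-⋁ {I} X = image⊆sum , sum⊆image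
    where
    image⊆sum : ∀ y → αₚ A._≈_ f (⨁ C X) y → ⨁ A (αₚ A._≈_ f ∘ X) y
    image⊆sum y (x , (xs , xs∈X , ⋁xs≈x) , fx≈y) =
      f ∘ xs , (λ i → xs i , xs∈X i , A.Eq.refl) ,
      A.Eq.trans (A.Eq.sym (f-⋁ xs)) (A.Eq.trans (monotone⇒cong f-mono ⋁xs≈x) fx≈y)

    sum⊆image : ∀ y → ⨁ A (αₚ A._≈_ f ∘ X) y → αₚ A._≈_ f (⨁ C X) y
    sum⊆image y (ys , ys∈fX , ⋁ys≈y) =
      C.⋁ xs , (xs , proj₁ ∘ proj₂ ∘ ys∈fX , C.Eq.refl) ,
      A.Eq.trans (f-⋁ xs) (A.Eq.trans (⋁-cong A (proj₂ ∘ proj₂ ∘ ys∈fX)) ⋁ys≈y)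
      where
      xs : I → C.Carrier
      xs = proj₁ ∘ ys∈fX

lemma5p3 : {c ℓ₁ ℓ₂ a m₁ m₂ ι s : Level}
    (C : CompleteLattice c ℓ₁ ℓ₂ ι) (A : CompleteLattice a m₁ m₂ ι)
    (α : CompleteLattice.Carrier C → CompleteLattice.Carrier A)
    (γ : CompleteLattice.Carrier A → CompleteLattice.Carrier C) →
    IsGaloisInsertion C A α γ →
    {I : Set ι} (X : I → 𝒫 s (CompleteLattice.Carrier C)) →
    _≐_ A (αₚ (CompleteLattice._≈_ A) α (⨁ C X))
          (⨁ A (λ i → αₚ (CompleteLattice._≈_ A) α (X i)))
lemma5p3 C A α γ G =
  αₚ-⨁ C A (IsGaloisInsertion.α-mono G) (galoisInsertion⇒preservesJoins C A G)
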